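{- Let $J$ be a symmetric subgraph of $K_{n,n}$. Then $\chi_\infty(K_n,J)$ is finite if and only if there are no $i\neq j$ in $\{1,\dots,n\}$ such that $J$ contains all three edges $(i,i')$, $(i,j')$, $(j,i')$.
   Context: Let $G=K_n$ be the complete graph with vertex set $\{v_1,\dots,v_n\}$. Let $K_{n,n}$ be the complete bipartite graph with parts $I_n=\{1,\dots,n\}$ and $I_n'=\{1',\dots,n'\}$; a subgraph $J$ of $K_{n,n}$ with vertex set $I_n\cup I_n'$ is symmetric if $i\sim j'$ iff $j\sim i'$. The self-similar graphs based on $(G,J)$: $G^1=G$; for $k\ge2$, $V(G^k)=V(G)^k$, and $(v_{i_1},\dots,v_{i_k})\sim(v_{j_1},\dots,v_{j_k})$ in $G^k$ iff either (1) $(v_{i_1},\dots,v_{i_{k-1}})=(v_{j_1},\dots,v_{j_{k-1}})$ and $v_{i_k}\sim v_{j_k}$ in $G$, or (2) $(v_{i_1},\dots,v_{i_{k-1}})\sim(v_{j_1},\dots,v_{j_{k-1}})$ in $G^{k-1}$ and $i_k\sim j_k'$ in $J$. The sequence $\chi(G^k)$ is non-decreasing; $\chi_\infty(G,J)$ denotes its limit, with $\chi_\infty(G,J)=\infty$ if it is unbounded. -}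

module Defs where

open import Data.Nat using (ℕ; zero; suc)
open import Data.Fin using (Fin)
open import Data.Vec using (Vec; []; _∷_)
open import Data.Bool using (Bool; true)
open import Data.Product using (_×_; Σ; ∃; ∃-syntax)
open import Data.Sum using (_⊎_)
open import Relation.Binary.PropositionalEquality using (_≡_; _≢_)
open import Relation.Nullary using (¬_)

-- A subgraph J of K_{n,n} on parts I_n, I_n' (all vertices kept):
-- J i j ≡ true  means  the edge i ~ j' is in J.
BipSub : ℕ → Set
BipSub n = Fin n → Fin n → Bool

SymmetricJ : {n : ℕ} → BipSub n → Set
SymmetricJ {n} J = (i j : Fin n) → J i j ≡ J j i

-- CONVENTION: the tuple (v_{i_1},...,v_{i_{k+1}}) is stored reversed,
-- i.e. the head of the vector is the LAST coordinate i_{k+1}.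
Vtx : ℕ → ℕ → Set
Vtx n k = Vec (Fin n) (suc k)

-- Adjacency in G^(k+1), G = K_n (so v_i ~ v_j in G iff i ≢ j).
Adj : {n : ℕ} → BipSub n → (k : ℕ) → Vtx n k → Vtx n k → Set
Adj J zero    (x ∷ []) (y ∷ []) = x ≢ y
Adj J (suc k) (x ∷ xs) (y ∷ ys) =
  (xs ≡ ys × x ≢ y) ⊎ (Adj J k xs ys × J x y ≡ true)

Colourable : {n : ℕ} → BipSub n → (k m : ℕ) → Set
Colourable {n} J k m =
  Σ (Vtx n k → Fin m) λ c → ∀ u v → Adj J k u v → c u ≢ c v

-- χ_∞(K_n, J) is finite: the non-decreasing sequence χ(G^k) is bounded.
ChiInftyFinite : {n : ℕ} → BipSub n → Set
ChiInftyFinite J = ∃[ m ] (∀ k → Colourable J k m)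

-- A loop at i together with the edges i j', j i' makes the vertices of G^(k+1) that carry
-- j in exactly one coordinate and i in all others pairwise adjacent: a (k+1)-clique, so
-- χ(G^(k+1)) ≥ k + 1 is unbounded.  Without such a configuration an edge of G^(k+1) between
-- tuples with the same last non-looped coordinate can only differ in one coordinate, with
-- equal looped coordinates after it; the sum of the coordinates modulo n then separates its
-- ends, so the pair (last non-looped coordinate, coordinate sum mod n) is a proper colouring
-- with (n + 1) n colours.
module Submission where

open import Defs
open import Data.Nat using (ℕ; zero; suc; _+_; _*_; _%_; NonZero)
open import Data.Nat.Properties using (+-comm; +-assoc; *-suc; n<1+n)
open import Data.Nat.DivMod using (_mod_; %-distribˡ-+; [m+kn]%n≡m%n; m<n⇒m%n≡m)
open import Data.Fin using (Fin; toℕ; combine) renaming (zero to fzero; suc to fsuc)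
open import Data.Fin.Properties
  using (toℕ-injective; toℕ<n; toℕ-fromℕ<; suc-injective; combine-injective; pigeonhole; <⇒≢; _≟_)
open import Data.Vec using (Vec; []; _∷_; replicate; _[_]≔_; map; sum)
open import Data.Bool using (true; false; if_then_else_)
open import Data.Product using (_×_; ∃-syntax; _,_)
open import Data.Sum using (inj₁; inj₂)
open import Data.Empty using (⊥)
open import Function using (flip)
open import Relation.Binary.PropositionalEquality
open import Relation.Nullary using (¬_; contradiction)
open import Relation.Nullary.Decidable using (decidable-stable)
open import Function.Bundles using (_⇔_; mk⇔)

LoopedPair : {n : ℕ} → BipSub n → Set
LoopedPair J = ∃[ i ] ∃[ j ] (i ≢ j × J i i ≡ true × J i j ≡ true × J j i ≡ true)

%-congʳ-+ : ∀ n .{{_ : NonZero n}} a b d → a % n ≡ b % n → (a + d) % n ≡ (b + d) % n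
%-congʳ-+ n a b d a≡b = begin
  (a + d) % n              ≡⟨ %-distribˡ-+ a d n ⟩
  (a % n + d % n) % n      ≡⟨ cong (λ r → (r + d % n) % n) a≡b ⟩
  (b % n + d % n) % n      ≡⟨ %-distribˡ-+ b d n ⟨
  (b + d) % n              ∎
  where open ≡-Reasoning

-- Adding c (n - 1) more copies of c turns + c into + c n, which vanishes modulo n.
%-cancelʳ-+ : ∀ n .{{_ : NonZero n}} a b c → (a + c) % n ≡ (b + c) % n → a % n ≡ b % n
%-cancelʳ-+ n@(suc n-1) a b c eq = begin
  a % n                    ≡⟨ [m+kn]%n≡m%n a c n ⟨
  (a + c * n) % n          ≡⟨ cong (_% n) (regroup a) ⟩
  (a + c + c * n-1) % n    ≡⟨ %-congʳ-+ n (a + c) (b + c) (c * n-1) eq ⟩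
  (b + c + c * n-1) % n    ≡⟨ cong (_% n) (regroup b) ⟨
  (b + c * n) % n          ≡⟨ [m+kn]%n≡m%n b c n ⟩
  b % n                    ∎
  where
  open ≡-Reasoning
  regroup : ∀ x → x + c * n ≡ x + c + c * n-1
  regroup x = trans (cong (x +_) (*-suc c n-1)) (sym (+-assoc x c (c * n-1)))

%-cancelˡ-+ : ∀ n .{{_ : NonZero n}} c a b → (c + a) % n ≡ (c + b) % n → a % n ≡ b % n
%-cancelˡ-+ n c a b eq rewrite +-comm c a | +-comm c b = %-cancelʳ-+ n a b c eq

toℕ-%-injective : ∀ {n} .{{_ : NonZero n}} {x y : Fin n} → toℕ x % n ≡ toℕ y % n → x ≡ y
toℕ-%-injective {n} {x = x} {y} eq = toℕ-injective (begin
  toℕ x      ≡⟨ m<n⇒m%n≡m (toℕ<n x) ⟨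
  toℕ x % n  ≡⟨ eq ⟩
  toℕ y % n  ≡⟨ m<n⇒m%n≡m (toℕ<n y) ⟩
  toℕ y      ∎)
  where open ≡-Reasoning

mod⇒% : ∀ {n} .{{_ : NonZero n}} {a b} → a mod n ≡ b mod n → a % n ≡ b % n
mod⇒% eq = trans (sym (toℕ-fromℕ< _)) (trans (cong toℕ eq) (toℕ-fromℕ< _))

Adj-flip : ∀ {n} (J : BipSub n) k {u v : Vtx n k} → Adj J k u v → Adj (flip J) k v u
Adj-flip J zero    {_ ∷ []} {_ ∷ []} x≢y                 = ≢-sym x≢y
Adj-flip J (suc k) {_ ∷ _}  {_ ∷ _}  (inj₁ (refl , x≢y)) = inj₁ (refl , ≢-sym x≢y)
Adj-flip J (suc k) {_ ∷ _}  {_ ∷ _}  (inj₂ (adj , Jxy))  = inj₂ (Adj-flip J k adj , Jxy)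

clique⇒¬Colourable : ∀ {n} {J : BipSub n} {k m} (K : Fin (suc m) → Vtx n k) →
  (∀ a b → a ≢ b → Adj J k (K a) (K b)) → ¬ Colourable J k m
clique⇒¬Colourable {m = m} K clique (c , proper)
  with a , b , a<b , same ← pigeonhole (n<1+n m) (λ a → c (K a))
  = proper (K a) (K b) (clique a b (<⇒≢ a<b)) same

module LoopedPairClique {n} (i j : Fin n) (i≢j : i ≢ j) where

  constant : ∀ k → Vtx n k
  constant k = replicate (suc k) i

  oneOff : ∀ k → Fin (suc k) → Vtx n k
  oneOff k a = constant k [ a ]≔ j

  constant-oneOff : (J : BipSub n) → J i i ≡ true → ∀ k a → Adj J k (constant k) (oneOff k a)
  constant-oneOff J Jii zero    fzero    = i≢j
  constant-oneOff J Jii (suc k) fzero    = inj₁ (refl , i≢j)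
  constant-oneOff J Jii (suc k) (fsuc a) = inj₂ (constant-oneOff J Jii k a , Jii)

  oneOff-clique : (J : BipSub n) → J i i ≡ true → J i j ≡ true → J j i ≡ true →
    ∀ k a b → a ≢ b → Adj J k (oneOff k a) (oneOff k b)
  oneOff-clique J Jii Jij Jji zero fzero fzero a≢b = contradiction refl a≢b
  oneOff-clique J Jii Jij Jji (suc k) fzero fzero a≢b = contradiction refl a≢b
  oneOff-clique J Jii Jij Jji (suc k) fzero (fsuc b) _ =
    inj₂ (constant-oneOff J Jii k b , Jji)
  oneOff-clique J Jii Jij Jji (suc k) (fsuc a) fzero _ =
    inj₂ (Adj-flip (flip J) k (constant-oneOff (flip J) Jii k a) , Jij)
  oneOff-clique J Jii Jij Jji (suc k) (fsuc a) (fsuc b) a≢b =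
    inj₂ (oneOff-clique J Jii Jij Jji k a b (λ a≡b → a≢b (cong fsuc a≡b)) , Jii)

LoopedPair⇒¬ChiInftyFinite : ∀ {n} (J : BipSub n) → LoopedPair J → ¬ ChiInftyFinite J
LoopedPair⇒¬ChiInftyFinite J (i , j , i≢j , Jii , Jij , Jji) (m , colourable) =
  clique⇒¬Colourable (oneOff m) (oneOff-clique J Jii Jij Jji m) (colourable m)
  where open LoopedPairClique i j i≢j

module LoopedPairFreeColouring {n} .{{_ : NonZero n}} (J : BipSub n)
    (symmetric : SymmetricJ J) (free : ¬ LoopedPair J) where

  looped-neighbour-≡ : ∀ {x y} → J x x ≡ true → J x y ≡ true → x ≡ y
  looped-neighbour-≡ {x} {y} Jxx Jxy =
    decidable-stable (x ≟ y) (λ x≢y → free (x , y , x≢y , Jxx , Jxy , trans (symmetric y x) Jxy))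

  -- fzero when every coordinate carries a loop; the head of the vector is the last coordinate.
  lastNonLooped : ∀ {l} → Vec (Fin n) l → Fin (suc n)
  lastNonLooped []       = fzero
  lastNonLooped (x ∷ xs) = if J x x then lastNonLooped xs else fsuc x

  lastNonLooped-looped : ∀ {l x} (xs : Vec (Fin n) l) → J x x ≡ true →
    lastNonLooped (x ∷ xs) ≡ lastNonLooped xs
  lastNonLooped-looped xs Jxx rewrite Jxx = refl

  lastNonLooped-≡⇒heads-≡ : ∀ {l x y} (xs ys : Vec (Fin n) l) → J x y ≡ true →
    lastNonLooped (x ∷ xs) ≡ lastNonLooped (y ∷ ys) → x ≡ y
  lastNonLooped-≡⇒heads-≡ {x = x} {y} xs ys Jxy same with J x x in Jxx | J y y in Jyy
  ... | true  | _     = looped-neighbour-≡ Jxx Jxy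
  ... | false | true  = sym (looped-neighbour-≡ Jyy (trans (symmetric y x) Jxy))
  ... | false | false = suc-injective same

  coordinateSum : ∀ {l} → Vec (Fin n) l → ℕ
  coordinateSum v = sum (map toℕ v)

  adjacent⇒invariants-differ : ∀ k (u v : Vtx n k) → Adj J k u v →
    lastNonLooped u ≡ lastNonLooped v → coordinateSum u % n ≡ coordinateSum v % n → ⊥
  adjacent⇒invariants-differ zero (x ∷ []) (y ∷ []) x≢y _ sums =
    x≢y (toℕ-%-injective (%-cancelʳ-+ n (toℕ x) (toℕ y) 0 sums))
  adjacent⇒invariants-differ (suc k) (x ∷ xs) (y ∷ xs) (inj₁ (refl , x≢y)) _ sums =
    x≢y (toℕ-%-injective (%-cancelʳ-+ n (toℕ x) (toℕ y) (coordinateSum xs) sums))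
  adjacent⇒invariants-differ (suc k) (x ∷ xs) (y ∷ ys) (inj₂ (adj , Jxy)) lasts sums
    with refl ← lastNonLooped-≡⇒heads-≡ xs ys Jxy lasts
    = adjacent⇒invariants-differ k xs ys adj
        (trans (sym (lastNonLooped-looped xs Jxy)) (trans lasts (lastNonLooped-looped ys Jxy)))
        (%-cancelˡ-+ n (toℕ x) (coordinateSum xs) (coordinateSum ys) sums)

  colour : ∀ {k} → Vtx n k → Fin (suc n * n)
  colour v = combine (lastNonLooped v) (coordinateSum v mod n)

  colourable : ∀ k → Colourable J k (suc n * n)
  colourable k = colour , λ u v adj same →
    let lasts , sums = combine-injective _ _ _ _ same
    in adjacent⇒invariants-differ k u v adj lasts (mod⇒% sums)

¬LoopedPair⇒ChiInftyFinite : ∀ {n} (J : BipSub n) → SymmetricJ J → ¬ LoopedPair J → ChiInftyFinite J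
¬LoopedPair⇒ChiInftyFinite {zero}  J _ _ = 0 , λ k → (λ { (() ∷ _) }) , λ { (() ∷ _) }
¬LoopedPair⇒ChiInftyFinite {suc n} J symmetric free =
  suc (suc n) * suc n , LoopedPairFreeColouring.colourable J symmetric free

theorem3p6 : (n : ℕ) (J : BipSub n) → SymmetricJ J →
    ChiInftyFinite J ⇔
      (¬ (∃[ i ] ∃[ j ] (i ≢ j × J i i ≡ true × J i j ≡ true × J j i ≡ true)))
theorem3p6 n J symmetric =
  mk⇔ (λ finite pair → LoopedPair⇒¬ChiInftyFinite J pair finite)
      (¬LoopedPair⇒ChiInftyFinite J symmetric)
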